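{- Let $n\ge 1$ and $k\ge 1$ be integers and let $K_{1,n-1}$ be the star of order $n$. Then $$1+\left\lceil \frac{n-k-1}{k+2}\right\rceil\leq \mathrm{va}_k^{\equiv}(K_{1,n-1})\leq \left\lceil\frac{n}{k}\right\rceil.$$ Moreover, these bounds are sharp (each is attained for some values of $n$ and $k$).
   Context: A $t$-coloring of a graph $G$ is any map $f:V(G)\to\{1,\dots,t\}$ (not necessarily proper), with color classes $V_i=f^{ -1}(i)$ (possibly empty); it is equitable if $||V_i|-|V_j||\le 1$ for all $i,j$. For a nonnegative integer $k$, a $(t,k)$-tree-coloring is a $t$-coloring such that every component of each induced subgraph $G[V_i]$ is a tree of maximum degree at most $k$. The strong equitable vertex $k$-arboricity $\mathrm{va}_k^{\equiv}(G)$ is the smallest positive integer $t$ such that $G$ has an equitable $(t',k)$-tree-coloring for every integer $t'\ge t$. -}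

module Defs where

open import Data.Nat using (ℕ; zero; suc; _+_; _∸_; _≤_; NonZero)
open import Data.Nat.DivMod using (_/_)
open import Data.Fin using (Fin; toℕ; inject₁; fromℕ; _≟_)
open import Data.List using (List; length; filter; allFin)
open import Data.Product using (Σ; _×_)
open import Data.Sum using (_⊎_)
open import Data.Empty using (⊥)
open import Relation.Binary.PropositionalEquality using (_≡_; _≢_)
open import Relation.Nullary using (¬_)

Graph : ℕ → Set₁
Graph n = Fin n → Fin n → Set

Star : (n : ℕ) → Graph n
Star n u v = (toℕ u ≡ 0 × toℕ v ≢ 0) ⊎ (toℕ u ≢ 0 × toℕ v ≡ 0)

⌈_/_⌉ : ℕ → (b : ℕ) → .{{NonZero b}} → ℕ
⌈ a / b ⌉ = (a + b ∸ 1) / b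

classSize : {n t : ℕ} → (Fin n → Fin t) → Fin t → ℕ
classSize {n} f i = length (filter (λ v → f v ≟ i) (allFin n))

Equitable : {n t : ℕ} → (Fin n → Fin t) → Set
Equitable f = ∀ i j → classSize f i ≤ suc (classSize f j)

-- every vertex has at most k neighbours of its own colour, i.e. there are
-- no k+1 distinct neighbours of v in the class of v (max degree of G[V_i] ≤ k)
BoundedClassDegree : {n t : ℕ} → Graph n → ℕ → (Fin n → Fin t) → Set
BoundedClassDegree {n} G k f =
  ∀ (v : Fin n) → ¬ (Σ (Fin (suc k) → Fin n) λ g →
      (∀ a b → g a ≡ g b → a ≡ b) × (∀ a → G v (g a) × f (g a) ≡ f v))

-- a monochromatic cycle: distinct vertices c_0, …, c_{p+2} (length ≥ 3), all in the
-- same colour class, with c_j adjacent to c_{j+1} and c_{p+2} adjacent to c_0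
MonoCycle : {n t : ℕ} → Graph n → (Fin n → Fin t) → Set
MonoCycle {n} G f = Σ ℕ λ p → Σ (Fin (suc (suc (suc p))) → Fin n) λ c →
    (∀ a b → c a ≡ c b → a ≡ b)
  × (∀ a → f (c a) ≡ f (c Fin.zero))
  × (∀ (a : Fin (suc (suc p))) → G (c (inject₁ a)) (c (Fin.suc a)))
  × G (c (fromℕ (suc (suc p)))) (c Fin.zero)
  where import Data.Fin as Fin

-- (t,k)-tree-colouring: every component of each G[V_i] is a tree of max degree ≤ k,
-- i.e. each G[V_i] is acyclic (a forest) and has maximum degree ≤ k.
TreeColoring : {n t : ℕ} → Graph n → ℕ → (Fin n → Fin t) → Set
TreeColoring G k f = BoundedClassDegree G k f × ¬ MonoCycle G f

EqTreeColorable : {n : ℕ} → Graph n → ℕ → ℕ → Set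
EqTreeColorable {n} G k t = Σ (Fin n → Fin t) λ f → Equitable f × TreeColoring G k f

StronglyColorableFrom : {n : ℕ} → Graph n → ℕ → ℕ → Set
StronglyColorableFrom G k t = ∀ t' → t ≤ t' → EqTreeColorable G k t'

IsStrongEqVA : {n : ℕ} → Graph n → ℕ → ℕ → Set
IsStrongEqVA G k t =
    1 ≤ t
  × StronglyColorableFrom G k t
  × (∀ s → 1 ≤ s → StronglyColorableFrom G k s → t ≤ s)

module Submission where

-- The star has no cycles, and a leaf sees only the centre, so for k ≥ 1 the
-- only constraint on an equitable (t,k)-tree-colouring is that the class of
-- the centre holds at most k + 1 vertices.  Equitability then bounds every
-- class by k + 2, and one class by k + 1, whence n < t(k + 2); conversely,
-- colouring the vertices cyclically 0, 1, …, t − 1 and a final incomplete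
-- round 1, …, r achieves this whenever n < t(k + 2).  Hence
-- va_k^≡(K_{1,n−1}) = 1 + ⌊n/(k + 2)⌋, which is the lower bound on the nose.

open import Defs
open import Data.Bool using (Bool; true; false; T; if_then_else_)
open import Data.Empty using (⊥-elim)
open import Data.Fin using (Fin; zero; suc; toℕ; _≟_; inject≤)
open import Data.Fin.Properties
  using (0≢1+n; injective⇒≤; toℕ-injective; suc-injective; inject≤-injective)
open import Data.List as List using (filter)
open import Data.Nat using (ℕ; zero; suc; _+_; _*_; _∸_; _≤_; _<_; z≤n; s≤s; NonZero; _≤?_)
open import Data.Nat.Base using (nonZero; ≢-nonZero⁻¹)
open import Data.Nat.DivMod
  using (_/_; _%_; m≡m%n+[m/n]*n; m%n<n; m<n⇒m/n≡0; m≥n⇒m/n>0; m<n*o⇒m/o<n)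
open import Data.Nat.Properties
  using ( ≤-refl; ≤-reflexive; ≤-trans; <⇒≤; <⇒≱; ≰⇒>; ≤-pred; n≤1+n; m≤n⇒m≤1+n; m≤m+n
        ; +-comm; +-assoc; +-suc; +-identityʳ; *-comm; *-suc; *-identityʳ
        ; ∸-+-assoc; m∸n+n≡m; m≤n⇒m∸n≡0
        ; +-mono-≤; +-monoˡ-≤; +-monoʳ-≤; +-monoˡ-<; *-monoˡ-≤; *-monoʳ-≤; +-cancelʳ-≤
        ; +-0-commutativeMonoid; module ≤-Reasoning )
open import Algebra.Properties.CommutativeMonoid.Sum +-0-commutativeMonoid
  using (sum-syntax; ∑-comm; sum-cong-≗; sum-replicate-zero)
open import Data.Product using (Σ; _×_; _,_; proj₁; proj₂)
open import Data.Sum using (inj₁; inj₂)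
open import Data.Unit using (tt)
open import Data.Vec using (Vec; []; _∷_; _++_; lookup; tabulate; concat; replicate; allFin)
open import Data.Vec.Functional as Vector using ()
open import Data.Vec.Properties using (lookup∘tabulate)
open import Function using (_∘_; id; Injective)
open import Relation.Binary.PropositionalEquality
  using (_≡_; _≢_; refl; sym; trans; cong; subst; module ≡-Reasoning)
open import Relation.Nullary using (¬_; Dec; does; yes; no)
open import Relation.Nullary.Decidable using (dec-true)

private
  variable
    a k m n t : ℕ

count : (Fin m → Bool) → ℕ
count {m} p = ∑[ v < m ] (if p v then 1 else 0)

count-cong : {p q : Fin m → Bool} → (∀ v → p v ≡ q v) → count p ≡ count q
count-cong p≗q = sum-cong-≗ (λ v → cong (λ b → if b then 1 else 0) (p≗q v))

∷-injective : {x : Fin m} {g : Fin a → Fin m} →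
              Injective _≡_ _≡_ g → (∀ i → g i ≢ x) → Injective _≡_ _≡_ (x Vector.∷ g)
∷-injective g-inj g≢x {zero}  {zero}  _  = refl
∷-injective g-inj g≢x {zero}  {suc j} eq = ⊥-elim (g≢x j (sym eq))
∷-injective g-inj g≢x {suc i} {zero}  eq = ⊥-elim (g≢x i eq)
∷-injective g-inj g≢x {suc i} {suc j} eq = cong suc (g-inj eq)

_↪_ : ℕ → (Fin m → Bool) → Set
_↪_ {m} a p = Σ (Fin a → Fin m) λ g → Injective _≡_ _≡_ g × (∀ i → T (p (g i)))

module _ {c : ℕ} where

  fresh : (b : Bool) → T b → Fin ((if b then 1 else 0) + c)
  fresh true _ = zero

  shift : (b : Bool) → Fin c → Fin ((if b then 1 else 0) + c)
  shift true  = suc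
  shift false = id

  fresh≢shift : ∀ b (tb : T b) i → fresh b tb ≢ shift b i
  fresh≢shift true _ _ ()

  shift-injective : ∀ b → Injective _≡_ _≡_ (shift b)
  shift-injective true  = suc-injective
  shift-injective false = id

rank : (p : Fin m → Bool) (u : Fin m) → T (p u) → Fin (count p)
rank p zero    pu = fresh (p zero) pu
rank p (suc u) pu = shift (p zero) (rank (p ∘ suc) u pu)

rank-injective : ∀ (p : Fin m → Bool) {u v} pu pv → rank p u pu ≡ rank p v pv → u ≡ v
rank-injective p {zero}  {zero}  pu pv eq = refl
rank-injective p {zero}  {suc v} pu pv eq = ⊥-elim (fresh≢shift (p zero) pu _ eq)
rank-injective p {suc u} {zero}  pu pv eq = ⊥-elim (fresh≢shift (p zero) pv _ (sym eq))
rank-injective p {suc u} {suc v} pu pv eq =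
  cong suc (rank-injective (p ∘ suc) pu pv (shift-injective (p zero) eq))

↪⇒≤count : (p : Fin m → Bool) → a ↪ p → a ≤ count p
↪⇒≤count p (g , g-inj , pg) =
  injective⇒≤ {f = λ i → rank p (g i) (pg i)} (g-inj ∘ rank-injective p (pg _) (pg _))

≤count⇒↪ : (p : Fin m → Bool) → a ≤ count p → a ↪ p
≤count⇒↪ {a = zero} p _ = (λ ()) , (λ { {()} }) , (λ ())
≤count⇒↪ {zero} {suc a} p ()
≤count⇒↪ {suc m} {suc a} p a<count with p zero in p0
... | true  = let g , g-inj , pg = ≤count⇒↪ (p ∘ suc) (≤-pred a<count) in
              zero Vector.∷ (suc ∘ g) , ∷-injective (g-inj ∘ suc-injective) (λ _ ())
            , λ { zero → subst T (sym p0) tt ; (suc i) → pg i }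
... | false = let g , g-inj , pg = ≤count⇒↪ (p ∘ suc) a<count in
              suc ∘ g , g-inj ∘ suc-injective , pg

count-false : count (λ (_ : Fin m) → false) ≡ 0
count-false {m} = sum-replicate-zero m

count≤1 : (p : Fin m → Bool) → ¬ (2 ↪ p) → count p ≤ 1
count≤1 p ¬2↪p with 2 ≤? count p
... | yes 2≤count = ⊥-elim (¬2↪p (≤count⇒↪ p 2≤count))
... | no  2≰count = ≤-pred (≰⇒> 2≰count)

length-filter-tabulate : ∀ {A : Set} {P : A → Set} (P? : ∀ x → Dec (P x)) (h : Fin m → A) →
                         List.length (filter P? (List.tabulate h)) ≡ count (λ u → does (P? (h u)))
length-filter-tabulate {zero}  P? h = refl
length-filter-tabulate {suc m} P? h with does (P? (h zero))
... | true  = cong suc (length-filter-tabulate P? (h ∘ suc))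
... | false = length-filter-tabulate P? (h ∘ suc)

_≟ᵇ_ : Fin t → Fin t → Bool
x ≟ᵇ y = does (x ≟ y)

≟ᵇ⇒≡ : {x y : Fin t} → T (x ≟ᵇ y) → x ≡ y
≟ᵇ⇒≡ {x = x} {y} x≟ᵇy with x ≟ y
... | yes x≡y = x≡y
... | no  _   = ⊥-elim x≟ᵇy

≡⇒≟ᵇ : {x y : Fin t} → x ≡ y → T (x ≟ᵇ y)
≡⇒≟ᵇ {x = x} {y} x≡y with x ≟ y
... | yes _   = tt
... | no  x≢y = x≢y x≡y

classSize≡count : (f : Fin n → Fin t) (i : Fin t) → classSize f i ≡ count (λ v → f v ≟ᵇ i)
classSize≡count f i = length-filter-tabulate (λ v → f v ≟ i) id

count-≟ᵇʳ : (x : Fin t) → count (x ≟ᵇ_) ≡ 1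
count-≟ᵇʳ {suc t} zero    = cong suc (count-false {t})
count-≟ᵇʳ         (suc x) = count-≟ᵇʳ x

count-≟ᵇˡ : (y : Fin t) → count (_≟ᵇ y) ≡ 1
count-≟ᵇˡ {suc t} zero    = cong suc (count-false {t})
count-≟ᵇˡ         (suc y) = count-≟ᵇˡ y

count-fibre-injective : (g : Fin m → Fin t) → Injective _≡_ _≡_ g → ∀ y → count (λ v → g v ≟ᵇ y) ≤ 1
count-fibre-injective g g-inj y = count≤1 _ λ (h , h-inj , gh≡y) →
  0≢1+n (h-inj (g-inj (trans (≟ᵇ⇒≡ (gh≡y zero)) (sym (≟ᵇ⇒≡ (gh≡y (suc zero)))))))

∑-const : ∀ n c → ∑[ i < n ] c ≡ n * c
∑-const zero    c = refl
∑-const (suc n) c = cong (c +_) (∑-const n c)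

∑-classSize : (f : Fin n → Fin t) → ∑[ i < t ] classSize f i ≡ n
∑-classSize {n} {t} f = begin
  ∑[ i < t ] classSize f i                             ≡⟨ sum-cong-≗ (classSize≡count f) ⟩
  ∑[ i < t ] ∑[ v < n ] (if f v ≟ᵇ i then 1 else 0)   ≡⟨ ∑-comm (λ i v → if f v ≟ᵇ i then 1 else 0) ⟩
  ∑[ v < n ] count (f v ≟ᵇ_)                           ≡⟨ sum-cong-≗ (count-≟ᵇʳ ∘ f) ⟩
  ∑[ v < n ] 1                                         ≡⟨ ∑-const n 1 ⟩
  n * 1                                                ≡⟨ *-identityʳ n ⟩
  n                                                    ∎
  where open ≡-Reasoning

∑-≤ : (g : Fin t → ℕ) {B : ℕ} → (∀ i → g i ≤ B) → ∑[ i < t ] g i ≤ t * B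
∑-≤ {zero}  g g≤B = z≤n
∑-≤ {suc t} g g≤B = +-mono-≤ (g≤B zero) (∑-≤ (g ∘ suc) (g≤B ∘ suc))

∑-< : (g : Fin t → ℕ) {B : ℕ} (c : Fin t) → (∀ i → g i ≤ B) → g c < B → ∑[ i < t ] g i < t * B
∑-< g zero    g≤B gc<B = +-mono-≤ gc<B (∑-≤ (g ∘ suc) (g≤B ∘ suc))
∑-< {suc t} g {B} (suc c) g≤B gc<B =
  subst (_≤ suc t * B) (+-suc (g zero) _) (+-mono-≤ (g≤B zero) (∑-< (g ∘ suc) c (g≤B ∘ suc) gc<B))

Star-irreflexive : {u : Fin n} → ¬ Star n u u
Star-irreflexive (inj₁ (u≡0 , u≢0)) = u≢0 u≡0
Star-irreflexive (inj₂ (u≢0 , u≡0)) = u≢0 u≡0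

Star-sym : {u v : Fin n} → Star n u v → Star n v u
Star-sym (inj₁ (u≡0 , v≢0)) = inj₂ (v≢0 , u≡0)
Star-sym (inj₂ (u≢0 , v≡0)) = inj₁ (v≡0 , u≢0)

Star-two-neighbours⇒centre : {u v w : Fin n} → Star n u v → Star n u w → v ≢ w → toℕ u ≡ 0
Star-two-neighbours⇒centre (inj₁ (u≡0 , _)) _                 _   = u≡0
Star-two-neighbours⇒centre (inj₂ _)         (inj₁ (u≡0 , _)) _   = u≡0
Star-two-neighbours⇒centre (inj₂ (_ , v≡0)) (inj₂ (_ , w≡0)) v≢w =
  ⊥-elim (v≢w (toℕ-injective (trans v≡0 (sym w≡0))))

-- Both c₀ and c₁ have two distinct neighbours on the cycle, so both are the centre.
Star-acyclic : (f : Fin n → Fin t) → ¬ MonoCycle (Star n) f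
Star-acyclic f (p , c , c-inj , _ , path , closing) =
  0≢1+n (c-inj _ _ (toℕ-injective (trans c₀-centre (sym c₁-centre))))
  where
  c₁-centre = Star-two-neighbours⇒centre (Star-sym (path zero)) (path (suc zero))
                                           (λ c₀≡c₂ → 0≢1+n (c-inj _ _ c₀≡c₂))
  c₀-centre = Star-two-neighbours⇒centre (path zero) (Star-sym closing)
                                           (λ c₁≡cₗ → 0≢1+n (suc-injective (c-inj _ _ c₁≡cₗ)))

classSize-centre : (f : Fin (suc m) → Fin t) →
                   classSize f (f zero) ≡ suc (count (λ u → f (suc u) ≟ᵇ f zero))
classSize-centre f = trans (classSize≡count f (f zero))
  (cong (λ b → (if b then 1 else 0) + count (λ u → f (suc u) ≟ᵇ f zero))
        (dec-true (f zero ≟ f zero) refl))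

boundedClassDegree⇒classSize-centre : (f : Fin (suc m) → Fin t) →
  BoundedClassDegree (Star (suc m)) k f → classSize f (f zero) ≤ suc k
boundedClassDegree⇒classSize-centre {k = k} f bounded
  rewrite classSize-centre f with suc k ≤? count (λ u → f (suc u) ≟ᵇ f zero)
... | no  k≮leaves = s≤s (≤-pred (≰⇒> k≮leaves))
... | yes k<leaves = let g , g-inj , g-same = ≤count⇒↪ _ k<leaves in
  ⊥-elim (bounded zero (suc ∘ g , (λ _ _ → g-inj ∘ suc-injective)
                       , λ a → inj₁ (refl , λ ()) , ≟ᵇ⇒≡ (g-same a)))

-- A vertex with two same-coloured neighbours is the centre, whose class then
-- contains the vertex itself besides its k + 2 neighbours.
classSize-centre⇒boundedClassDegree : (f : Fin n → Fin t) →
  (∀ c → toℕ c ≡ 0 → classSize f (f c) ≤ suc (suc k)) → BoundedClassDegree (Star n) (suc k) f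
classSize-centre⇒boundedClassDegree {n} {k = k} f centre≤ v (g , g-inj , g-prop) =
  <⇒≱ class-large (centre≤ v v-centre)
  where
  v-centre : toℕ v ≡ 0
  v-centre = Star-two-neighbours⇒centre (proj₁ (g-prop zero)) (proj₁ (g-prop (suc zero)))
                                         (0≢1+n ∘ g-inj _ _)
  g≢v : ∀ a → g a ≢ v
  g≢v a ga≡v = Star-irreflexive (subst (Star n v) ga≡v (proj₁ (g-prop a)))
  class-large : suc (suc (suc k)) ≤ classSize f (f v)
  class-large = subst (_ ≤_) (sym (classSize≡count f (f v)))
    (↪⇒≤count _ (v Vector.∷ g , ∷-injective (g-inj _ _) g≢v
                , λ { zero → ≡⇒≟ᵇ {x = f v} refl ; (suc a) → ≡⇒≟ᵇ (proj₂ (g-prop a)) }))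

eqTreeColorable⇒< : EqTreeColorable (Star (suc m)) k t → suc m < t * suc (suc k)
eqTreeColorable⇒< {m} {k} {t} (f , equitable , bounded , _) =
  subst (_< t * suc (suc k)) (∑-classSize f) (∑-< (classSize f) (f zero) class≤ (s≤s centre≤))
  where
  centre≤ = boundedClassDegree⇒classSize-centre f bounded
  class≤ : ∀ i → classSize f i ≤ suc (suc k)
  class≤ i = ≤-trans (equitable i (f zero)) (s≤s centre≤)

occurrences : Fin t → Vec (Fin t) n → ℕ
occurrences i xs = count (λ v → lookup xs v ≟ᵇ i)

occurrences-++ : (i : Fin t) (xs : Vec (Fin t) m) (ys : Vec (Fin t) n) →
                 occurrences i (xs ++ ys) ≡ occurrences i xs + occurrences i ys
occurrences-++ i []       ys = refl
occurrences-++ i (x ∷ xs) ys =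
  trans (cong (_ +_) (occurrences-++ i xs ys)) (sym (+-assoc (if x ≟ᵇ i then 1 else 0) _ _))

occurrences-concat-replicate : (i : Fin t) (q : ℕ) (xs : Vec (Fin t) n) →
                               occurrences i (concat (replicate q xs)) ≡ q * occurrences i xs
occurrences-concat-replicate i zero    xs = refl
occurrences-concat-replicate i (suc q) xs =
  trans (occurrences-++ i xs _) (cong (_ +_) (occurrences-concat-replicate i q xs))

occurrences-tabulate : (i : Fin t) (g : Fin n → Fin t) →
                       occurrences i (tabulate g) ≡ count (λ v → g v ≟ᵇ i)
occurrences-tabulate i g = count-cong (λ v → cong (_≟ᵇ i) (lookup∘tabulate g v))

finalColour : {r t : ℕ} → r ≤ t → Fin r → Fin (suc t)
finalColour r≤t j = suc (inject≤ j r≤t)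

finalRound : {r t : ℕ} → r ≤ t → Vec (Fin (suc t)) r
finalRound r≤t = tabulate (finalColour r≤t)

finalRound-occurrences≤1 : ∀ {r} (r≤t : r ≤ t) i → occurrences i (finalRound r≤t) ≤ 1
finalRound-occurrences≤1 r≤t i = subst (_≤ 1) (sym (occurrences-tabulate i (finalColour r≤t)))
  (count-fibre-injective (finalColour r≤t) (inject≤-injective r≤t r≤t _ _ ∘ suc-injective) i)

finalRound-occurrences-0 : ∀ {r} (r≤t : r ≤ t) → occurrences zero (finalRound r≤t) ≡ 0
finalRound-occurrences-0 {r = r} r≤t =
  trans (occurrences-tabulate zero (finalColour r≤t)) (count-false {r})

-- Colour 0 is left out of the final round, so its class is never overfull, and
-- it is the colour of the centre as soon as q ≥ 1.
roundRobin : (q : ℕ) {r t : ℕ} → r ≤ t → Vec (Fin (suc t)) (q * suc t + r)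
roundRobin q {t = t} r≤t = concat (replicate q (allFin (suc t))) ++ finalRound r≤t

roundRobin-classSize : (q : ℕ) {r : ℕ} (r≤t : r ≤ t) (i : Fin (suc t)) →
  classSize (lookup (roundRobin q r≤t)) i ≡ q + occurrences i (finalRound r≤t)
roundRobin-classSize {t} q r≤t i = begin
  classSize (lookup (roundRobin q r≤t)) i
    ≡⟨ classSize≡count (lookup (roundRobin q r≤t)) i ⟩
  occurrences i (concat (replicate q (allFin (suc t))) ++ finalRound r≤t)
    ≡⟨ occurrences-++ i (concat (replicate q (allFin (suc t)))) (finalRound r≤t) ⟩
  occurrences i (concat (replicate q (allFin (suc t)))) + occurrences i (finalRound r≤t)
    ≡⟨ cong (_+ occurrences i (finalRound r≤t)) (occurrences-concat-replicate i q _) ⟩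
  q * occurrences i (allFin (suc t)) + occurrences i (finalRound r≤t)
    ≡⟨ cong (λ c → q * c + occurrences i (finalRound r≤t))
            (trans (occurrences-tabulate i id) (count-≟ᵇˡ i)) ⟩
  q * 1 + occurrences i (finalRound r≤t)
    ≡⟨ cong (_+ occurrences i (finalRound r≤t)) (*-identityʳ q) ⟩
  q + occurrences i (finalRound r≤t)
    ∎
  where open ≡-Reasoning

roundRobin-equitable : (q : ℕ) {r : ℕ} (r≤t : r ≤ t) → Equitable (lookup (roundRobin q r≤t))
roundRobin-equitable q r≤t i j
  rewrite roundRobin-classSize q r≤t i | roundRobin-classSize q r≤t j = begin
    q + occurrences i (finalRound r≤t)      ≤⟨ +-monoʳ-≤ q (finalRound-occurrences≤1 r≤t i) ⟩
    q + 1                                   ≡⟨ +-comm q 1 ⟩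
    suc q                                   ≤⟨ s≤s (m≤m+n q _) ⟩
    suc (q + occurrences j (finalRound r≤t)) ∎
  where open ≤-Reasoning

roundRobin-centre : (q : ℕ) {r : ℕ} (r≤t : r ≤ t) → q ≤ suc (suc k) → ∀ c → toℕ c ≡ 0 →
  classSize (lookup (roundRobin q r≤t)) (lookup (roundRobin q r≤t) c) ≤ suc (suc k)
roundRobin-centre zero r≤t _ c _
  rewrite roundRobin-classSize zero r≤t (lookup (roundRobin zero r≤t) c) =
    ≤-trans (finalRound-occurrences≤1 r≤t _) (s≤s z≤n)
roundRobin-centre (suc q) r≤t q≤2+k zero _
  rewrite roundRobin-classSize (suc q) r≤t zero | finalRound-occurrences-0 r≤t =
    ≤-trans (≤-reflexive (+-identityʳ (suc q))) q≤2+k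

roundRobin-eqTreeColorable : (q : ℕ) {r : ℕ} → r ≤ t → q ≤ suc (suc k) →
                             EqTreeColorable (Star (q * suc t + r)) (suc k) (suc t)
roundRobin-eqTreeColorable q r≤t q≤ =
    lookup (roundRobin q r≤t) , roundRobin-equitable q r≤t
  , classSize-centre⇒boundedClassDegree _ (roundRobin-centre q r≤t q≤)
  , Star-acyclic (lookup (roundRobin q r≤t))

<⇒eqTreeColorable : n < t * suc (suc (suc k)) → EqTreeColorable (Star n) (suc k) t
<⇒eqTreeColorable {n} {suc t} {k} n<t[3+k] =
  subst (λ n → EqTreeColorable (Star n) (suc k) (suc t)) (sym n≡q[1+t]+r)
        (roundRobin-eqTreeColorable (n / suc t) (≤-pred (m%n<n n (suc t))) q≤2+k)
  where
  n≡q[1+t]+r : n ≡ n / suc t * suc t + n % suc t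
  n≡q[1+t]+r = trans (m≡m%n+[m/n]*n n (suc t)) (+-comm (n % suc t) _)
  q≤2+k : n / suc t ≤ suc (suc k)
  q≤2+k = ≤-pred (m<n*o⇒m/o<n (subst (n <_) (*-comm (suc t) _) n<t[3+k]))

m/n<o⇒m<o*n : ∀ {m n o} .{{_ : NonZero n}} → m / n < o → m < o * n
m/n<o⇒m<o*n {m} {n} {o} m/n<o = begin-strict
  m                   ≡⟨ m≡m%n+[m/n]*n m n ⟩
  m % n + m / n * n   <⟨ +-monoˡ-< (m / n * n) (m%n<n m n) ⟩
  suc (m / n) * n     ≤⟨ *-monoˡ-≤ n m/n<o ⟩
  o * n               ∎
  where open ≤-Reasoning

⌈n∸k∸1/2+k⌉≡n/2+k : ∀ n k → ⌈ n ∸ k ∸ 1 / suc (suc k) ⌉ ≡ n / suc (suc k)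
⌈n∸k∸1/2+k⌉≡n/2+k n k = begin
  ⌈ n ∸ k ∸ 1 / suc (suc k) ⌉        ≡⟨ cong (λ x → (x ∸ 1) / suc (suc k)) (+-suc (n ∸ k ∸ 1) (suc k)) ⟩
  (n ∸ k ∸ 1 + suc k) / suc (suc k)  ≡⟨ cong (λ x → (x + suc k) / suc (suc k)) n∸k∸1≡n∸[1+k] ⟩
  (n ∸ suc k + suc k) / suc (suc k)  ≡⟨ n∸[1+k]+[1+k]/[2+k] ⟩
  n / suc (suc k)                     ∎
  where
  open ≡-Reasoning
  n∸k∸1≡n∸[1+k] : n ∸ k ∸ 1 ≡ n ∸ suc k
  n∸k∸1≡n∸[1+k] = trans (∸-+-assoc n k 1) (cong (n ∸_) (+-comm k 1))
  n∸[1+k]+[1+k]/[2+k] : (n ∸ suc k + suc k) / suc (suc k) ≡ n / suc (suc k)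
  n∸[1+k]+[1+k]/[2+k] with suc k ≤? n
  ... | yes 1+k≤n = cong (_/ suc (suc k)) (m∸n+n≡m 1+k≤n)
  ... | no  1+k≰n rewrite m≤n⇒m∸n≡0 (<⇒≤ (≰⇒> 1+k≰n)) =
    trans (m<n⇒m/n≡0 {suc k} {suc (suc k)} ≤-refl) (sym (m<n⇒m/n≡0 (m≤n⇒m≤1+n (≰⇒> 1+k≰n))))

n≤⌈n/1+k⌉*[1+k] : ∀ n k → n ≤ ⌈ n / suc k ⌉ * suc k
n≤⌈n/1+k⌉*[1+k] n k = +-cancelʳ-≤ k n _ (begin
  n + k                                              ≡⟨ cong (_∸ 1) (+-suc n k) ⟨
  n + suc k ∸ 1                                      ≡⟨ m≡m%n+[m/n]*n (n + suc k ∸ 1) (suc k) ⟩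
  (n + suc k ∸ 1) % suc k + ⌈ n / suc k ⌉ * suc k    ≤⟨ +-monoˡ-≤ _ (≤-pred (m%n<n (n + suc k ∸ 1) (suc k))) ⟩
  k + ⌈ n / suc k ⌉ * suc k                          ≡⟨ +-comm k _ ⟩
  ⌈ n / suc k ⌉ * suc k + k                          ∎)
  where open ≤-Reasoning

n<⌈n/1+k⌉*[3+k] : ∀ n k → 1 ≤ n → n < ⌈ n / suc k ⌉ * suc (suc (suc k))
n<⌈n/1+k⌉*[3+k] n k 1≤n = begin-strict
  n                              ≤⟨ n≤⌈n/1+k⌉*[1+k] n k ⟩
  c * suc k                      ≤⟨ *-monoʳ-≤ c (n≤1+n (suc k)) ⟩
  c * suc (suc k)                <⟨ +-monoˡ-≤ (c * suc (suc k)) 1≤c ⟩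
  c + c * suc (suc k)            ≡⟨ *-suc c (suc (suc k)) ⟨
  c * suc (suc (suc k))          ∎
  where
  open ≤-Reasoning
  c = ⌈ n / suc k ⌉
  1≤c : 1 ≤ c
  1≤c = m≥n⇒m/n>0 (subst (suc k ≤_) (cong (_∸ 1) (sym (+-suc n k))) (+-monoˡ-≤ k 1≤n))

Star-isStrongEqVA : IsStrongEqVA (Star (suc m)) (suc k) (suc (suc m / suc (suc (suc k))))
Star-isStrongEqVA {m} {k} = s≤s z≤n , colorable , minimal
  where
  colorable : StronglyColorableFrom (Star (suc m)) (suc k) (suc (suc m / suc (suc (suc k))))
  colorable t q<t = <⇒eqTreeColorable (m/n<o⇒m<o*n q<t)
  minimal : ∀ s → 1 ≤ s → StronglyColorableFrom (Star (suc m)) (suc k) s →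
            suc (suc m / suc (suc (suc k))) ≤ s
  minimal s _ colorable-s = m<n*o⇒m/o<n (eqTreeColorable⇒< (colorable-s s ≤-refl))

Star-strongEqVA-bounds : ∀ (n k : ℕ) → 1 ≤ n → .{{_ : NonZero k}} →
  Σ ℕ λ t → IsStrongEqVA (Star n) k t
    × 1 + ⌈ n ∸ k ∸ 1 / suc (suc k) ⌉ ≤ t
    × t ≤ ⌈ n / k ⌉
Star-strongEqVA-bounds (suc m) (suc k) _ =
    suc (suc m / suc (suc (suc k)))
  , Star-isStrongEqVA
  , s≤s (≤-reflexive (⌈n∸k∸1/2+k⌉≡n/2+k (suc m) (suc k)))
  , m<n*o⇒m/o<n (n<⌈n/1+k⌉*[3+k] (suc m) k (s≤s z≤n))
Star-strongEqVA-bounds _ zero _ = ⊥-elim (≢-nonZero⁻¹ 0 refl)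

proposition2p2 :
    (∀ (n k : ℕ) → 1 ≤ n → .{{_ : NonZero k}} →
      Σ ℕ λ t → IsStrongEqVA (Star n) k t
        × 1 + ⌈ n ∸ k ∸ 1 / suc (suc k) ⌉ ≤ t
        × t ≤ ⌈ n / k ⌉)
    × (Σ ℕ λ n → Σ ℕ λ k → Σ (NonZero k) λ nz → 1 ≤ n × (Σ ℕ λ t → IsStrongEqVA (Star n) k t
        × t ≡ 1 + ⌈ n ∸ k ∸ 1 / suc (suc k) ⌉))
    × (Σ ℕ λ n → Σ ℕ λ k → Σ (NonZero k) λ nz → 1 ≤ n × (Σ ℕ λ t → IsStrongEqVA (Star n) k t
        × t ≡ ⌈ n / k ⌉ {{nz}}))
proposition2p2 =
    Star-strongEqVA-bounds
  , (1 , 1 , nonZero , s≤s z≤n , 1 , Star-isStrongEqVA , refl)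
  , (1 , 1 , nonZero , s≤s z≤n , 1 , Star-isStrongEqVA , refl)
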